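{- Let $\pi$ be a permutation of $[2n]$ consisting of two disjoint $n$-cycles. Then the number of pairs $(\sigma,\tau)$ of involutions of $[2n]$ with $\pi=\tau\circ\sigma$ such that the superposition $\sigma\cup\tau$ is a single cycle on all $2n$ vertices is $n$.
   Context: An involution is a permutation all of whose cycles have length $1$ or $2$. The superposition $\sigma\cup\tau$ is the multigraph on the ground set with a solid edge $\{i,\sigma(i)\}$ for each $2$-cycle of $\sigma$ and a dotted edge $\{i,\tau(i)\}$ for each $2$-cycle of $\tau$ (a $2$-cycle common to both gives two parallel edges, which forms a cycle on $2$ vertices). -}

module Defs where

open import Data.Nat using (ℕ; zero; suc; _+_; _*_; _<_)
open import Data.Fin using (Fin)
open import Data.Fin.Permutation using (Permutation′; _⟨$⟩ʳ_)
open import Data.Product using (Σ; Σ-syntax; _×_; _,_; proj₁; proj₂)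
open import Relation.Binary.PropositionalEquality using (_≡_; _≢_)
open import Relation.Binary.Construct.Closure.ReflexiveTransitive using (Star)
open import Data.Sum using (_⊎_)

iter : ∀ {m} → Permutation′ m → ℕ → Fin m → Fin m
iter π zero    i = i
iter π (suc k) i = π ⟨$⟩ʳ (iter π k i)

-- π consists of two disjoint n-cycles (on [2n]): every point lies in an
-- orbit of length exactly n (so, as 2n points are permuted, there are
-- exactly two cycles, each of length n).
TwoNCycles : (n : ℕ) → Permutation′ (2 * n) → Set
TwoNCycles n π =
  (i : Fin (2 * n)) →
    (iter π n i ≡ i) × ((k : ℕ) → 0 < k → k < n → iter π k i ≢ i)

IsInvolution : ∀ {m} → Permutation′ m → Set
IsInvolution {m} σ = (i : Fin m) → σ ⟨$⟩ʳ (σ ⟨$⟩ʳ i) ≡ i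

-- Superposition σ ∪ τ (for involutions σ, τ): solid edge {i, σ i} for each
-- 2-cycle of σ, dotted edge {i, τ i} for each 2-cycle of τ.
-- Adjacency in the multigraph:
Adj : ∀ {m} → Permutation′ m → Permutation′ m → Fin m → Fin m → Set
Adj σ τ i j = ((σ ⟨$⟩ʳ i ≡ j) × (σ ⟨$⟩ʳ i ≢ i))
            ⊎ ((τ ⟨$⟩ʳ i ≡ j) × (τ ⟨$⟩ʳ i ≢ i))

-- Degree of vertex i in σ ∪ τ is 2 iff i lies on a solid edge and on a
-- dotted edge (each involution contributes at most one edge at i).
HasDegreeTwo : ∀ {m} → Permutation′ m → Permutation′ m → Fin m → Set
HasDegreeTwo σ τ i = (σ ⟨$⟩ʳ i ≢ i) × (τ ⟨$⟩ʳ i ≢ i)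

-- σ ∪ τ is a single cycle on all vertices: a connected 2-regular multigraph
-- on the whole ground set (a double edge counts as a cycle on 2 vertices).
SingleCycle : ∀ {m} → Permutation′ m → Permutation′ m → Set
SingleCycle {m} σ τ =
  ((i : Fin m) → HasDegreeTwo σ τ i) ×
  ((i j : Fin m) → Star (Adj σ τ) i j)

_≗ₚ_ : ∀ {m} → Permutation′ m → Permutation′ m → Set
_≗ₚ_ {m} σ σ′ = (i : Fin m) → σ ⟨$⟩ʳ i ≡ σ′ ⟨$⟩ʳ i

PermPair : ℕ → Set
PermPair m = Permutation′ m × Permutation′ m

_≈pair_ : ∀ {m} → PermPair m → PermPair m → Set
(σ , τ) ≈pair (σ′ , τ′) = (σ ≗ₚ σ′) × (τ ≗ₚ τ′)

Factorisation : ∀ {m} → Permutation′ m → PermPair m → Set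
Factorisation {m} π (σ , τ) =
  IsInvolution σ × IsInvolution τ ×
  ((i : Fin m) → π ⟨$⟩ʳ i ≡ τ ⟨$⟩ʳ (σ ⟨$⟩ʳ i)) ×
  SingleCycle σ τ

-- "The set {x : A | P x}, with elements identified up to _≈_, has exactly
-- k elements": there is an enumeration Fin k → {x | P x} that is injective
-- and surjective up to _≈_.
HasExactly : (k : ℕ) (A : Set) (_≈_ : A → A → Set) (P : A → Set) → Set
HasExactly k A _≈_ P =
  Σ[ f ∈ (Fin k → Σ A P) ]
    (((a b : Fin k) → proj₁ (f a) ≈ proj₁ (f b) → a ≡ b) ×
     ((x : A) → P x → Σ[ a ∈ Fin k ] (proj₁ (f a) ≈ x)))

-- Write aₖ = πᵏ a and bₖ = πᵏ b for the two cycles of π. If π = τσ with σ, τ involutions, then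
-- π σ π = σ, so σ aₖ = π⁻ᵏ (σ a) and σ is determined by σ a. Were σ a on the cycle of a, that
-- cycle would be closed under σ and τ = πσ, and σ ∪ τ would be disconnected; hence σ a = b_J and
-- σ is the reflection aₖ ↔ b_{J−k}. Conversely, for each J mod n this reflection and τ = πσ are
-- fixed-point-free involutions with π = τσ, and the alternating path a₀, σ a₀, a₁, σ a₁, …
-- visits every vertex.

module Submission where

open import Defs
open import Algebra.Definitions using (Involutive)
open import Data.Bool using (Bool; true; false; not)
open import Data.Bool.Properties using (not-involutive; not-¬)
open import Data.Empty using (⊥-elim)
open import Data.Fin using (Fin; zero; suc; toℕ; splitAt; join)
open import Data.Fin.Permutation using (Permutation′; _⟨$⟩ʳ_; permutation)
open import Data.Fin.Properties
  using (_≟_; any?; ¬∀⟶∃¬; <⇒notInjective; toℕ<n; toℕ-injective; toℕ-fromℕ<; join-splitAt)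
open import Data.Nat using (ℕ; zero; suc; _+_; _*_; _∸_; _<_; _≤_; s≤s; z≤n)
open import Data.Nat.DivMod
  using (_%_; _/_; _mod_; m≡m%n+[m/n]*n; m%n<n; m%n%n≡m%n; m<n⇒m%n≡m; [m+n]%n≡m%n; m*n%n≡0;
         %-distribˡ-+; %-distribˡ-*)
open import Data.Nat.Properties
  using (n<1+n; m<m+n; <⇒≤; ≤-<-trans; <-cmp; m<n⇒0<n∸m; m∸n≤m; m∸n+n≡m;
         +-comm; +-assoc; +-identityʳ; *-suc; +-commutativeSemigroup)
open import Data.Product using (Σ; ∃; _×_; _,_; proj₁; proj₂; curry; uncurry; map₂)
open import Data.Sum using (_⊎_; inj₁; inj₂)
open import Function using (_∘_; id)
open import Function.Bundles using (Injection)
open import Function.Definitions using (Injective; StrictlySurjective)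
open import Function.Properties.Inverse using (↔⇒↣)
open import Level using (0ℓ)
open import Relation.Binary.Bundles using (Setoid)
open import Relation.Binary.Definitions using (Symmetric; tri<; tri≈; tri>)
open import Relation.Binary.Structures using (IsEquivalence)
open import Relation.Binary.Construct.Closure.ReflexiveTransitive
  using (Star; ε; _◅_; _◅◅_; fold; reverse)
open import Relation.Binary.PropositionalEquality
  using (_≡_; _≢_; refl; sym; trans; cong; cong₂; subst; module ≡-Reasoning)
import Relation.Binary.Reasoning.Setoid as SetoidReasoning
open import Relation.Nullary using (¬_)
open import Relation.Nullary.Decidable using (decidable-stable)
open import Algebra.Properties.CommutativeSemigroup +-commutativeSemigroup using (x∙yz≈y∙xz)

private
  variable
    k l m : ℕ

∃∉image : k < m → (f : Fin k → Fin m) → ∃ λ y → ∀ i → f i ≢ y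
∃∉image {k} {m} k<m f =
  map₂ curry (¬∀⟶∃¬ m _ (λ y → any? (λ i → f i ≟ y)) (<⇒notInjective k<m ∘ preimage-injective))
  where
  preimage-injective : (onto : ∀ y → ∃ λ i → f i ≡ y) → Injective _≡_ _≡_ (proj₁ ∘ onto)
  preimage-injective onto {y} {y′} eq =
    trans (sym (proj₂ (onto y))) (trans (cong f eq) (proj₂ (onto y′)))

injective⇒surjective : {f : Fin m → Fin m} → Injective _≡_ _≡_ f → StrictlySurjective _≡_ f
injective⇒surjective {m} {f} f-injective y =
  decidable-stable (any? (λ x → f x ≟ y)) (<⇒notInjective (n<1+n m) ∘ extension-injective)
  where
  extension : Fin (suc m) → Fin m
  extension zero    = y
  extension (suc i) = f i

  extension-injective : ¬ (∃ λ x → f x ≡ y) → Injective _≡_ _≡_ extension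
  extension-injective y∉ {zero}  {zero}  _  = refl
  extension-injective y∉ {zero}  {suc j} eq = ⊥-elim (y∉ (j , sym eq))
  extension-injective y∉ {suc i} {zero}  eq = ⊥-elim (y∉ (i , eq))
  extension-injective y∉ {suc i} {suc j} eq = cong suc (f-injective eq)

involutionPermutation : (f : Fin m → Fin m) → Involutive _≡_ f → Permutation′ m
involutionPermutation f f-involutive = permutation f f f-involutive f-involutive

module _ {a} {A : Set a} where

  -- For an involution σ this says σ π σ = π⁻¹.
  _Reverses_ : (A → A) → (A → A) → Set a
  σ Reverses π = ∀ x → π (σ (π x)) ≡ σ x

  reverses⇒∘-involutive : {σ π : A → A} → Involutive _≡_ σ → σ Reverses π → Involutive _≡_ (π ∘ σ)
  reverses⇒∘-involutive σ-involutive σ-reverses x = trans (σ-reverses _) (σ-involutive x)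

  factorisation-reverses : {σ τ π : A → A} → Involutive _≡_ σ → Involutive _≡_ τ →
                           (∀ x → π x ≡ τ (σ x)) → σ Reverses π
  factorisation-reverses {σ} {τ} {π} σ-involutive τ-involutive π≡τσ x = begin
    π (σ (π x))      ≡⟨ π≡τσ _ ⟩
    τ (σ (σ (π x)))  ≡⟨ cong τ (σ-involutive _) ⟩
    τ (π x)          ≡⟨ cong τ (π≡τσ x) ⟩
    τ (τ (σ x))      ≡⟨ τ-involutive _ ⟩
    σ x              ∎
    where open ≡-Reasoning

  involutions-agree-at-image : {f g : A → A} → Involutive _≡_ f → Involutive _≡_ g →
                               ∀ z → f z ≡ g z → f (g z) ≡ g (g z)
  involutions-agree-at-image {f} {g} f-involutive g-involutive z fz≡gz =
    trans (cong f (sym fz≡gz)) (trans (f-involutive z) (sym (g-involutive z)))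

module _ {σ τ : Permutation′ m} (σ-involutive : IsInvolution σ) (τ-involutive : IsInvolution τ)
         where

  private
    reverse-edge : {f : Fin m → Fin m} {i j : Fin m} → Involutive _≡_ f →
                   (f i ≡ j) × (f i ≢ i) → (f j ≡ i) × (f j ≢ j)
    reverse-edge {i = i} f-involutive (refl , fi≢i) =
      f-involutive i , λ ffi≡fi → fi≢i (sym (trans (sym (f-involutive i)) ffi≡fi))

  Adj-sym : Symmetric (Adj σ τ)
  Adj-sym (inj₁ edge) = inj₁ (reverse-edge σ-involutive edge)
  Adj-sym (inj₂ edge) = inj₂ (reverse-edge τ-involutive edge)

Star-connected : ∀ {a r} {A : Set a} {R : A → A → Set r} {x : A} → Symmetric R →
                 (∀ y → Star R x y) → ∀ y z → Star R y z
Star-connected R-sym reach y z = reverse R-sym (reach y) ◅◅ reach z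

module Modulo (n′ : ℕ) where

  n : ℕ
  n = suc n′

  -- A record rather than k % n ≡ l % n, so that k and l can be inferred from a proof.
  infix 4 _≋_
  record _≋_ (k l : ℕ) : Set where
    constructor mod≡
    field %≡% : k % n ≡ l % n
  open _≋_ public

  ≋-isEquivalence : IsEquivalence _≋_
  ≋-isEquivalence = record
    { refl  = mod≡ refl
    ; sym   = λ k≋l → mod≡ (sym (%≡% k≋l))
    ; trans = λ k≋l l≋m → mod≡ (trans (%≡% k≋l) (%≡% l≋m))
    }

  ≋-setoid : Setoid 0ℓ 0ℓ
  ≋-setoid = record { isEquivalence = ≋-isEquivalence }

  module ≋-Reasoning = SetoidReasoning ≋-setoid

  open IsEquivalence ≋-isEquivalence public
    using () renaming (refl to ≋-refl; sym to ≋-sym; trans to ≋-trans; reflexive to ≡⇒≋)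

  +-cong : ∀ {a b c d} → a ≋ b → c ≋ d → a + c ≋ b + d
  +-cong {a} {b} {c} {d} (mod≡ a≋b) (mod≡ c≋d) = mod≡ (begin
    (a + c) % n              ≡⟨ %-distribˡ-+ a c n ⟩
    (a % n + c % n) % n      ≡⟨ cong₂ (λ u v → (u + v) % n) a≋b c≋d ⟩
    (b % n + d % n) % n      ≡⟨ %-distribˡ-+ b d n ⟨
    (b + d) % n              ∎)
    where open ≡-Reasoning

  n+≋ : n + k ≋ k
  n+≋ {k} = mod≡ (trans (cong (_% n) (+-comm n k)) ([m+n]%n≡m%n k n))

  mod-≋ : toℕ (k mod n) ≋ k
  mod-≋ {k} = mod≡ (trans (cong (_% n) (toℕ-fromℕ< (m%n<n k n))) (m%n%n≡m%n k n))

  <-≋⇒≡ : k < n → l < n → k ≋ l → k ≡ l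
  <-≋⇒≡ k<n l<n (mod≡ k≋l) = trans (sym (m<n⇒m%n≡m k<n)) (trans k≋l (m<n⇒m%n≡m l<n))

  -- neg k represents −k, since k + k * n′ = k * n.
  neg : ℕ → ℕ
  neg k = k * n′

  neg-cong : k ≋ l → neg k ≋ neg l
  neg-cong {k} {l} (mod≡ k≋l) = mod≡ (begin
    (k * n′) % n              ≡⟨ %-distribˡ-* k n′ n ⟩
    (k % n * (n′ % n)) % n    ≡⟨ cong (λ u → (u * (n′ % n)) % n) k≋l ⟩
    (l % n * (n′ % n)) % n    ≡⟨ %-distribˡ-* l n′ n ⟨
    (l * n′) % n              ∎)
    where open ≡-Reasoning

  +-neg : k + neg k ≋ 0
  +-neg {k} = mod≡ (trans (cong (_% n) (sym (*-suc k n′))) (m*n%n≡0 k n))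

  mirror : ℕ → ℕ → ℕ
  mirror J k = J + neg k

  mirror-cong : ∀ J → k ≋ l → mirror J k ≋ mirror J l
  mirror-cong J = +-cong ≋-refl ∘ neg-cong

  mirror-unique : ∀ {J r} → k + r ≋ J → mirror J k ≋ r
  mirror-unique {k} {J} {r} k+r≋J = begin
    J + neg k          ≈⟨ +-cong (≋-sym k+r≋J) ≋-refl ⟩
    k + r + neg k      ≡⟨ cong (_+ neg k) (+-comm k r) ⟩
    r + k + neg k      ≡⟨ +-assoc r k (neg k) ⟩
    r + (k + neg k)    ≈⟨ +-cong ≋-refl (+-neg {k}) ⟩
    r + 0              ≡⟨ +-identityʳ r ⟩
    r                  ∎
    where open ≋-Reasoning

  mirror-involutive : ∀ J k → mirror J (mirror J k) ≋ k
  mirror-involutive J k = mirror-unique (begin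
    J + neg k + k    ≡⟨ +-assoc J (neg k) k ⟩
    J + (neg k + k)  ≡⟨ cong (J +_) (+-comm (neg k) k) ⟩
    J + (k + neg k)  ≈⟨ +-cong ≋-refl (+-neg {k}) ⟩
    J + 0            ≡⟨ +-identityʳ J ⟩
    J                ∎)
    where open ≋-Reasoning

  mirror-suc : ∀ J k → suc (mirror J (suc k)) ≋ mirror J k
  mirror-suc J k = begin
    suc (J + (n′ + neg k))  ≡⟨ cong suc (x∙yz≈y∙xz J n′ (neg k)) ⟩
    n + (J + neg k)         ≈⟨ n+≋ ⟩
    J + neg k               ∎
    where open ≋-Reasoning

iter-+ : (π : Permutation′ m) (k l : ℕ) (x : Fin m) → iter π (k + l) x ≡ iter π k (iter π l x)
iter-+ π zero    l x = refl
iter-+ π (suc k) l x = cong (π ⟨$⟩ʳ_) (iter-+ π k l x)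

OrbitsOfLength : ℕ → Permutation′ m → Set
OrbitsOfLength {m} n π = (i : Fin m) → (iter π n i ≡ i) × ((k : ℕ) → 0 < k → k < n → iter π k i ≢ i)

module Orbits {m} (n′ : ℕ) (π : Permutation′ m) (orbits : OrbitsOfLength (suc n′) π) where

  open Modulo n′

  π-injective : Injective _≡_ _≡_ (π ⟨$⟩ʳ_)
  π-injective = Injection.injective (↔⇒↣ π)

  iter-* : ∀ q x → iter π (q * n) x ≡ x
  iter-* zero    x = refl
  iter-* (suc q) x = begin
    iter π (n + q * n) x      ≡⟨ iter-+ π n (q * n) x ⟩
    iter π n (iter π (q * n) x) ≡⟨ cong (iter π n) (iter-* q x) ⟩
    iter π n x                ≡⟨ proj₁ (orbits x) ⟩
    x                         ∎
    where open ≡-Reasoning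

  iter-% : ∀ k x → iter π k x ≡ iter π (k % n) x
  iter-% k x = begin
    iter π k x                            ≡⟨ cong (λ j → iter π j x) (m≡m%n+[m/n]*n k n) ⟩
    iter π (k % n + k / n * n) x          ≡⟨ iter-+ π (k % n) (k / n * n) x ⟩
    iter π (k % n) (iter π (k / n * n) x) ≡⟨ cong (iter π (k % n)) (iter-* (k / n) x) ⟩
    iter π (k % n) x                      ∎
    where open ≡-Reasoning

  iter-cong : ∀ {x} → k ≋ l → iter π k x ≡ iter π l x
  iter-cong {k} {l} {x} (mod≡ k≋l) =
    trans (iter-% k x) (trans (cong (λ j → iter π j x) k≋l) (sym (iter-% l x)))

  iter-neg : ∀ k x → iter π (neg k) (iter π k x) ≡ x
  iter-neg k x = trans (sym (iter-+ π (neg k) k x))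
                       (iter-cong (≋-trans (≡⇒≋ (+-comm (neg k) k)) (+-neg {k})))

  iter-<-injective : ∀ {x} → k < l → l < n → iter π k x ≢ iter π l x
  iter-<-injective {k} {l} {x} k<l l<n πᵏx≡πˡx =
    proj₂ (orbits (iter π k x)) (l ∸ k) (m<n⇒0<n∸m k<l) (≤-<-trans (m∸n≤m l k) l<n) (begin
      iter π (l ∸ k) (iter π k x)  ≡⟨ iter-+ π (l ∸ k) k x ⟨
      iter π (l ∸ k + k) x         ≡⟨ cong (λ j → iter π j x) (m∸n+n≡m (<⇒≤ k<l)) ⟩
      iter π l x                   ≡⟨ πᵏx≡πˡx ⟨
      iter π k x                   ∎)
    where open ≡-Reasoning

  iter-<n-injective : ∀ {x} → k < n → l < n → iter π k x ≡ iter π l x → k ≡ l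
  iter-<n-injective {k} {l} k<n l<n πᵏx≡πˡx with <-cmp k l
  ... | tri< k<l _ _ = ⊥-elim (iter-<-injective k<l l<n πᵏx≡πˡx)
  ... | tri≈ _ k≡l _ = k≡l
  ... | tri> _ _ l<k = ⊥-elim (iter-<-injective l<k k<n (sym πᵏx≡πˡx))

  iter-injective : ∀ {x} → iter π k x ≡ iter π l x → k ≋ l
  iter-injective {k} {l} {x} πᵏx≡πˡx = mod≡ (iter-<n-injective (m%n<n k n) (m%n<n l n)
    (trans (sym (iter-% k x)) (trans πᵏx≡πˡx (iter-% l x))))

  reverses-iter : {f : Fin m → Fin m} → f Reverses (π ⟨$⟩ʳ_) →
                  ∀ k x → f (iter π k x) ≡ iter π (neg k) (f x)
  reverses-iter f-reverses zero    x = refl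
  reverses-iter {f} f-reverses (suc k) x = π-injective (begin
    π ⟨$⟩ʳ f (π ⟨$⟩ʳ iter π k x)        ≡⟨ f-reverses (iter π k x) ⟩
    f (iter π k x)                      ≡⟨ reverses-iter f-reverses k x ⟩
    iter π (neg k) (f x)                ≡⟨ iter-cong (≋-sym n+≋) ⟩
    iter π (suc (n′ + neg k)) (f x)     ∎)
    where open ≡-Reasoning

module TwoCycles (n′ : ℕ) (π : Permutation′ (2 * suc n′)) (orbits : TwoNCycles (suc n′) π) where

  open Modulo n′
  open Orbits n′ π orbits

  N : ℕ
  N = 2 * n

  a : Fin N
  a = zero

  private
    outside-orbit-a : ∃ λ b → ∀ (i : Fin n) → iter π (toℕ i) a ≢ b
    outside-orbit-a = ∃∉image (m<m+n n (s≤s z≤n)) (λ i → iter π (toℕ i) a)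

  b : Fin N
  b = proj₁ outside-orbit-a

  b∉orbit-a : ∀ k → iter π k a ≢ b
  b∉orbit-a k = proj₂ outside-orbit-a (k mod n) ∘ trans (iter-cong {x = a} (mod-≋ {k}))

  base : Bool → Fin N
  base false = a
  base true  = b

  point : Bool → ℕ → Fin N
  point s k = iter π k (base s)

  orbits-disjoint : ∀ k l → point false k ≢ point true l
  orbits-disjoint k l πᵏa≡πˡb = b∉orbit-a (neg l + k) (begin
    iter π (neg l + k) a            ≡⟨ iter-+ π (neg l) k a ⟩
    iter π (neg l) (point false k)  ≡⟨ cong (iter π (neg l)) πᵏa≡πˡb ⟩
    iter π (neg l) (point true l)   ≡⟨ iter-neg l b ⟩
    b                               ∎)
    where open ≡-Reasoning

  point-side : ∀ {s s′ k l} → point s k ≡ point s′ l → s ≡ s′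
  point-side {false} {false}         _  = refl
  point-side {false} {true}  {k} {l} eq = ⊥-elim (orbits-disjoint k l eq)
  point-side {true}  {false} {k} {l} eq = ⊥-elim (orbits-disjoint l k (sym eq))
  point-side {true}  {true}          _  = refl

  point-not : ∀ s k l → point (not s) k ≢ point s l
  point-not s k l eq = not-¬ refl (sym (point-side {not s} {s} {k} {l} eq))

  -- N = 2 * n unfolds to n + (n + 0), whence the Fin (n + 0) below.
  private
    coordinates : Fin n ⊎ Fin (n + 0) → Bool × ℕ
    coordinates (inj₁ k) = false , toℕ k
    coordinates (inj₂ k) = true  , toℕ k

    toℕ<n′ : (k : Fin (n + 0)) → toℕ k < n
    toℕ<n′ k = subst (toℕ k <_) (+-identityʳ n) (toℕ<n k)

    coordinates-injective : ∀ {u v} →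
      uncurry point (coordinates u) ≡ uncurry point (coordinates v) → u ≡ v
    coordinates-injective {inj₁ k} {inj₁ l} eq =
      cong inj₁ (toℕ-injective (<-≋⇒≡ (toℕ<n k) (toℕ<n l) (iter-injective eq)))
    coordinates-injective {inj₁ k} {inj₂ l} eq = ⊥-elim (orbits-disjoint (toℕ k) (toℕ l) eq)
    coordinates-injective {inj₂ k} {inj₁ l} eq = ⊥-elim (orbits-disjoint (toℕ l) (toℕ k) (sym eq))
    coordinates-injective {inj₂ k} {inj₂ l} eq =
      cong inj₂ (toℕ-injective (<-≋⇒≡ (toℕ<n′ k) (toℕ<n′ l) (iter-injective eq)))

    enumerate : Fin N → Fin N
    enumerate i = uncurry point (coordinates (splitAt n i))

    enumerate-injective : Injective _≡_ _≡_ enumerate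
    enumerate-injective {i} {j} eq = begin
      i                             ≡⟨ join-splitAt n (n + 0) i ⟨
      join n (n + 0) (splitAt n i)  ≡⟨ cong (join n (n + 0))
                                             (coordinates-injective {splitAt n i} {splitAt n j} eq) ⟩
      join n (n + 0) (splitAt n j)  ≡⟨ join-splitAt n (n + 0) j ⟩
      j                             ∎
      where open ≡-Reasoning

  locate : Fin N → Bool × ℕ
  locate x = coordinates (splitAt n (proj₁ (injective⇒surjective enumerate-injective x)))

  point-locate : ∀ x → uncurry point (locate x) ≡ x
  point-locate x = proj₂ (injective⇒surjective enumerate-injective x)

  point-elim : (P : Fin N → Set) → (∀ s k → P (point s k)) → ∀ x → P x
  point-elim P P-point x = subst P (point-locate x) (P-point (proj₁ (locate x)) (proj₂ (locate x)))

  module Reflection (J : ℕ) where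

    reflect : Fin N → Fin N
    reflect x = point (not (proj₁ (locate x))) (mirror J (proj₂ (locate x)))

    reflect-point : ∀ s k → reflect (point s k) ≡ point (not s) (mirror J k)
    reflect-point s k with locate (point s k) | point-locate (point s k)
    ... | s′ , k′ | eq with point-side {s′} {s} {k′} {k} eq
    ... | refl = iter-cong (mirror-cong J (iter-injective {k′} {k} eq))

    reflect-involutive : Involutive _≡_ reflect
    reflect-involutive = point-elim (λ x → reflect (reflect x) ≡ x) λ s k → begin
      reflect (reflect (point s k))                ≡⟨ cong reflect (reflect-point s k) ⟩
      reflect (point (not s) (mirror J k))         ≡⟨ reflect-point (not s) (mirror J k) ⟩
      point (not (not s)) (mirror J (mirror J k))  ≡⟨ cong (λ t → point t (mirror J (mirror J k)))
                                                           (not-involutive s) ⟩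
      point s (mirror J (mirror J k))              ≡⟨ iter-cong (mirror-involutive J k) ⟩
      point s k                                    ∎
      where open ≡-Reasoning

    reflect-reverses : reflect Reverses (π ⟨$⟩ʳ_)
    reflect-reverses = point-elim (λ x → π ⟨$⟩ʳ reflect (π ⟨$⟩ʳ x) ≡ reflect x) λ s k → begin
      π ⟨$⟩ʳ reflect (point s (suc k))        ≡⟨ cong (π ⟨$⟩ʳ_) (reflect-point s (suc k)) ⟩
      point (not s) (suc (mirror J (suc k)))  ≡⟨ iter-cong (mirror-suc J k) ⟩
      point (not s) (mirror J k)              ≡⟨ reflect-point s k ⟨
      reflect (point s k)                     ∎
      where open ≡-Reasoning

    reflect-a : reflect a ≡ point true J
    reflect-a = trans (reflect-point false 0) (cong (point true) (+-identityʳ J))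

    reflect-orbit-a : ∀ k → reflect (point false (mirror J k)) ≡ point true k
    reflect-orbit-a k = trans (reflect-point false (mirror J k)) (iter-cong (mirror-involutive J k))

    reflect-unique : {f : Fin N → Fin N} → Involutive _≡_ f →
                     (∀ k → f (point false k) ≡ reflect (point false k)) → ∀ x → f x ≡ reflect x
    reflect-unique {f} f-involutive agree-on-orbit-a =
      point-elim (λ x → f x ≡ reflect x) λ { false → agree-on-orbit-a ; true → agree-on-orbit-b }
      where
      open ≡-Reasoning
      agree-on-orbit-b : ∀ k → f (point true k) ≡ reflect (point true k)
      agree-on-orbit-b k = begin
        f (point true k)                              ≡⟨ cong f (reflect-orbit-a k) ⟨
        f (reflect (point false (mirror J k)))        ≡⟨ involutions-agree-at-image {f = f} {reflect}
                                                           f-involutive reflect-involutive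
                                                           (point false (mirror J k))
                                                           (agree-on-orbit-a (mirror J k)) ⟩
        reflect (reflect (point false (mirror J k)))  ≡⟨ cong reflect (reflect-orbit-a k) ⟩
        reflect (point true k)                        ∎

    twist : Fin N → Fin N
    twist = (π ⟨$⟩ʳ_) ∘ reflect

    twist-involutive : Involutive _≡_ twist
    twist-involutive = reverses⇒∘-involutive {π = π ⟨$⟩ʳ_} reflect-involutive reflect-reverses

    σᴶ τᴶ : Permutation′ N
    σᴶ = involutionPermutation reflect reflect-involutive
    τᴶ = involutionPermutation twist twist-involutive

    reflect-fixed-point-free : ∀ x → reflect x ≢ x
    reflect-fixed-point-free = point-elim (λ x → reflect x ≢ x) λ s k →
      point-not s (mirror J k) k ∘ trans (sym (reflect-point s k))

    twist-fixed-point-free : ∀ x → twist x ≢ x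
    twist-fixed-point-free = point-elim (λ x → twist x ≢ x) λ s k →
      point-not s (suc (mirror J k)) k ∘ trans (sym (cong (π ⟨$⟩ʳ_) (reflect-point s k)))

    σ-edge : ∀ x → Adj σᴶ τᴶ x (reflect x)
    σ-edge x = inj₁ (refl , reflect-fixed-point-free x)

    π-path : ∀ x → Star (Adj σᴶ τᴶ) x (π ⟨$⟩ʳ x)
    π-path x = σ-edge x ◅ subst (Adj σᴶ τᴶ (reflect x)) (cong (π ⟨$⟩ʳ_) (reflect-involutive x))
                                 (inj₂ (refl , twist-fixed-point-free (reflect x))) ◅ ε

    orbit-a-reachable : ∀ k → Star (Adj σᴶ τᴶ) a (point false k)
    orbit-a-reachable zero    = ε
    orbit-a-reachable (suc k) = orbit-a-reachable k ◅◅ π-path (point false k)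

    reachable : ∀ x → Star (Adj σᴶ τᴶ) a x
    reachable = point-elim (Star (Adj σᴶ τᴶ) a) λ where
      false k → orbit-a-reachable k
      true  k → subst (Star (Adj σᴶ τᴶ) a) (reflect-orbit-a k)
                      (orbit-a-reachable (mirror J k) ◅◅ σ-edge (point false (mirror J k)) ◅ ε)

    factorisation : Factorisation π (σᴶ , τᴶ)
    factorisation =
      reflect-involutive , twist-involutive , (λ x → cong (π ⟨$⟩ʳ_) (sym (reflect-involutive x))) ,
      (λ x → reflect-fixed-point-free x , twist-fixed-point-free x) ,
      Star-connected (Adj-sym {σ = σᴶ} {τ = τᴶ} reflect-involutive twist-involutive) reachable

  module Classification {σ τ : Permutation′ N}
    (σ-involutive : IsInvolution σ) (τ-involutive : IsInvolution τ)
    (π≡τσ : ∀ x → π ⟨$⟩ʳ x ≡ τ ⟨$⟩ʳ (σ ⟨$⟩ʳ x)) where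

    τ≡πσ : ∀ x → τ ⟨$⟩ʳ x ≡ π ⟨$⟩ʳ (σ ⟨$⟩ʳ x)
    τ≡πσ x = trans (cong (τ ⟨$⟩ʳ_) (sym (σ-involutive x))) (sym (π≡τσ (σ ⟨$⟩ʳ x)))

    σ-orbit-a : ∀ k → σ ⟨$⟩ʳ point false k ≡ iter π (neg k) (σ ⟨$⟩ʳ a)
    σ-orbit-a k = reverses-iter {f = σ ⟨$⟩ʳ_}
      (factorisation-reverses {σ = σ ⟨$⟩ʳ_} {τ ⟨$⟩ʳ_} {π ⟨$⟩ʳ_} σ-involutive τ-involutive π≡τσ) k a

    InOrbit-a : Fin N → Set
    InOrbit-a x = ∃ λ k → point false k ≡ x

    σa-in-orbit-b : (∀ x y → Star (Adj σ τ) x y) → ∃ λ r → σ ⟨$⟩ʳ a ≡ point true r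
    σa-in-orbit-b connected with locate (σ ⟨$⟩ʳ a) | point-locate (σ ⟨$⟩ʳ a)
    ... | true  , r | πʳb≡σa = r , sym πʳb≡σa
    -- Otherwise the orbit of a is closed under both kinds of edges, so b is unreachable.
    ... | false , r | πʳa≡σa = ⊥-elim (uncurry b∉orbit-a (fold (λ x y → InOrbit-a x → InOrbit-a y)
            (λ edge rest → rest ∘ edge-closed edge) id (connected a b) (0 , refl)))
      where
      σ-closed : ∀ k → InOrbit-a (σ ⟨$⟩ʳ point false k)
      σ-closed k = neg k + r , (begin
        iter π (neg k + r) a              ≡⟨ iter-+ π (neg k) r a ⟩
        iter π (neg k) (point false r)    ≡⟨ cong (iter π (neg k)) πʳa≡σa ⟩
        iter π (neg k) (σ ⟨$⟩ʳ a)         ≡⟨ σ-orbit-a k ⟨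
        σ ⟨$⟩ʳ point false k              ∎)
        where open ≡-Reasoning

      edge-closed : ∀ {x y} → Adj σ τ x y → InOrbit-a x → InOrbit-a y
      edge-closed (inj₁ (refl , _)) (k , refl) = σ-closed k
      edge-closed (inj₂ (refl , _)) (k , refl) with σ-closed k
      ... | j , πʲa≡σx = suc j , trans (cong (π ⟨$⟩ʳ_) πʲa≡σx) (sym (τ≡πσ (point false k)))

    module _ (r : ℕ) (σa≡πʳb : σ ⟨$⟩ʳ a ≡ point true r) where

      J : ℕ
      J = toℕ (r mod n)

      open Reflection J

      σ-agrees-on-orbit-a : ∀ k → σ ⟨$⟩ʳ point false k ≡ reflect (point false k)
      σ-agrees-on-orbit-a k = begin
        σ ⟨$⟩ʳ point false k               ≡⟨ σ-orbit-a k ⟩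
        iter π (neg k) (σ ⟨$⟩ʳ a)          ≡⟨ cong (iter π (neg k)) σa≡πʳb ⟩
        iter π (neg k) (point true r)      ≡⟨ iter-+ π (neg k) r b ⟨
        point true (neg k + r)             ≡⟨ cong (point true) (+-comm (neg k) r) ⟩
        point true (r + neg k)             ≡⟨ iter-cong (+-cong (≋-sym (mod-≋ {r})) ≋-refl) ⟩
        point true (mirror J k)            ≡⟨ reflect-point false k ⟨
        reflect (point false k)            ∎
        where open ≡-Reasoning

      σ≗reflect : ∀ x → σ ⟨$⟩ʳ x ≡ reflect x
      σ≗reflect = reflect-unique σ-involutive σ-agrees-on-orbit-a

      reflection≈pair : (σᴶ , τᴶ) ≈pair (σ , τ)
      reflection≈pair =
        sym ∘ σ≗reflect , λ x → trans (cong (π ⟨$⟩ʳ_) (sym (σ≗reflect x))) (sym (τ≡πσ x))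

  reflections : Fin n → Σ (PermPair N) (Factorisation π)
  reflections j = (σᴶ , τᴶ) , factorisation
    where open Reflection (toℕ j)

  reflections-injective : ∀ i j → proj₁ (reflections i) ≈pair proj₁ (reflections j) → i ≡ j
  reflections-injective i j (σⁱ≗σʲ , _) =
    toℕ-injective (<-≋⇒≡ (toℕ<n i) (toℕ<n j) (iter-injective {toℕ i} {toℕ j} (begin
      point true (toℕ i)              ≡⟨ Reflection.reflect-a (toℕ i) ⟨
      Reflection.reflect (toℕ i) a    ≡⟨ σⁱ≗σʲ a ⟩
      Reflection.reflect (toℕ j) a    ≡⟨ Reflection.reflect-a (toℕ j) ⟩
      point true (toℕ j)              ∎)))
    where open ≡-Reasoning

  reflections-surjective : ∀ {σ τ} → Factorisation π (σ , τ) →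
                           ∃ λ j → proj₁ (reflections j) ≈pair (σ , τ)
  reflections-surjective {σ} {τ} (σ-involutive , τ-involutive , π≡τσ , _ , connected) =
    let open Classification {σ} {τ} σ-involutive τ-involutive π≡τσ
        r , σa≡πʳb = σa-in-orbit-b connected
    in  r mod n , reflection≈pair r σa≡πʳb

mainTheorem18 : (n : ℕ) → 1 ≤ n → (π : Permutation′ (2 * n)) → TwoNCycles n π →
    HasExactly n (PermPair (2 * n)) _≈pair_ (Factorisation π)
mainTheorem18 zero    ()
mainTheorem18 (suc n′) _ π orbits =
  reflections , reflections-injective , λ { (σ , τ) → reflections-surjective {σ} {τ} }
  where open TwoCycles n′ π orbits
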